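{- Let $S\subset\mathbb{Z}^2$ be realizable and let $(\widehat{G},\widehat{W})$ be its canonical realization, with $\widehat{W}=\{\omega_1,\omega_2\}$. Suppose $x\in S$ and there is a shortest path in $\widehat{G}$ between $\omega_2$ and $x$ passing through an edge $uv$. Suppose that for some integers $\alpha,\beta$ one of the following holds: (i) $u=(\alpha+1,\beta)$, $v=(\alpha,\beta+1)$, $t=(\alpha,\beta)\in S$; (ii) $u=(\alpha+1,\beta)$, $v=(\alpha+1,\beta+1)$, $t=(\alpha,\beta)\in S$; (iii) $u=(\alpha+2,\beta)$, $v=(\alpha+1,\beta+1)$, $t=(\alpha,\beta)\in S$; (iv) $u=(\alpha,\beta)$, $v=(\alpha+1,\beta+1)$, $t=(\alpha+2,\beta)\in S$. Then $\omega_2\ne u$ and there exists a shortest path in $\widehat{G}$ between $\omega_2$ and $x$ avoiding the edge $uv$. Moreover, in such a case the graph $\widehat{G}-uv$ is connected.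
   Context: A finite set $S\subset\mathbb{Z}^2$ is realizable if there are a finite simple connected graph $G$ and an ordered vertex set $W=(\omega_1,\omega_2)$ such that the map $u\mapsto (d(u,\omega_1),d(u,\omega_2))$ ($d$ the shortest-path distance) is injective on $V(G)$ with image $S$. For realizable $S$, the canonical realization $(\widehat{G},\widehat{W})$ is: $V(\widehat{G})=S$; $x,y\in S$ adjacent iff $\max(\vert x_1-y_1\vert,\vert x_2-y_2\vert)=1$; $\omega_i$ is the unique element of $S$ with $i$-th coordinate $0$, and $\widehat{W}=\{\omega_1,\omega_2\}$. In this realization, $d_{\widehat{G}}(x,\omega_i)=x_i$ for all $x\in S$. -}

module Defs where

open import Data.Nat using (ℕ; zero; suc; _≤_; _⊔_)
open import Data.Integer using (ℤ; +_; _+_; _-_; ∣_∣)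
open import Data.Bool using (Bool; true; false)
open import Data.Fin using (Fin)
open import Data.Product using (Σ; ∃; _×_; _,_; proj₁; proj₂)
open import Data.Sum using (_⊎_)
open import Data.Empty using (⊥)
open import Data.List using (List)
open import Data.List.Membership.Propositional using (_∈_)
open import Relation.Nullary using (¬_)
open import Relation.Binary.PropositionalEquality using (_≡_; _≢_)
open import Function.Definitions using (Injective)
open import Function.Bundles using (_⇔_)

record Graph : Set where
  field
    n     : ℕ
    E     : Fin n → Fin n → Bool
    sym   : ∀ u v → E u v ≡ E v u
    irrefl : ∀ u → E u u ≡ false

module _ (G : Graph) where
  open Graph G

  data GWalk : Fin n → Fin n → Set where
    gstay : ∀ {a} → GWalk a a
    gstep : ∀ {a b c} → E a b ≡ true → GWalk b c → GWalk a c

  glength : ∀ {a b} → GWalk a b → ℕ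
  glength gstay = zero
  glength (gstep _ w) = suc (glength w)

  GConnected : Set
  GConnected = ∀ a b → GWalk a b

  HasDist : Fin n → Fin n → ℕ → Set
  HasDist a b k = (Σ (GWalk a b) λ w → glength w ≡ k) × (∀ (w : GWalk a b) → k ≤ glength w)

  HasDistℤ : Fin n → Fin n → ℤ → Set
  HasDistℤ a b z = Σ ℕ λ k → (z ≡ + k) × HasDist a b k

Pt : Set
Pt = ℤ × ℤ

Realizable : List Pt → Set
Realizable S =
  Σ Graph λ G → GConnected G ×
  Σ (Fin (Graph.n G)) λ ω₁ → Σ (Fin (Graph.n G)) λ ω₂ →
  Σ (Fin (Graph.n G) → Pt) λ r →
    (∀ u → HasDistℤ G u ω₁ (proj₁ (r u)) × HasDistℤ G u ω₂ (proj₂ (r u))) ×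
    Injective _≡_ _≡_ r ×
    (∀ p → (p ∈ S) ⇔ (∃ λ u → r u ≡ p))

-- Canonical realization Ĝ on S: x ~ y iff max(|x₁-y₁|,|x₂-y₂|) = 1

Adj : Pt → Pt → Set
Adj (x₁ , x₂) (y₁ , y₂) = (∣ x₁ - y₁ ∣ ⊔ ∣ x₂ - y₂ ∣) ≡ 1

data Walk (S : List Pt) : Pt → Pt → Set where
  stay : ∀ {a} → a ∈ S → Walk S a a
  step : ∀ {a b c} → a ∈ S → Adj a b → Walk S b c → Walk S a c

len : ∀ {S a b} → Walk S a b → ℕ
len (stay _) = zero
len (step _ _ w) = suc (len w)

UsesEdge : ∀ {S a b} → Pt → Pt → Walk S a b → Set
UsesEdge u v (stay _) = ⊥
UsesEdge u v (step {a} {b} _ _ w) =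
  ((a ≡ u × b ≡ v) ⊎ (a ≡ v × b ≡ u)) ⊎ UsesEdge u v w

Shortest : ∀ {S a b} → Walk S a b → Set
Shortest {S} {a} {b} w = ∀ (w' : Walk S a b) → len w ≤ len w'

ConnectedMinusEdge : List Pt → Pt → Pt → Set
ConnectedMinusEdge S u v =
  ∀ a b → a ∈ S → b ∈ S → Σ (Walk S a b) λ w → ¬ UsesEdge u v w

Config : List Pt → ℤ → ℤ → Pt → Pt → Set
Config S α β u v =
    (u ≡ (α + + 1 , β) × v ≡ (α , β + + 1) × (α , β) ∈ S)
  ⊎ (u ≡ (α + + 1 , β) × v ≡ (α + + 1 , β + + 1) × (α , β) ∈ S)
  ⊎ (u ≡ (α + + 2 , β) × v ≡ (α + + 1 , β + + 1) × (α , β) ∈ S)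
  ⊎ (u ≡ (α , β) × v ≡ (α + + 1 , β + + 1) × (α + + 2 , β) ∈ S)

-- In a realization the second coordinate of a point, its level, is its distance to ω₂.
-- Hence every point on level k + 1 has a neighbour in Ĝ on level k, and no edge of Ĝ changes
-- the level by more than one, so a walk that descends one level per step from x to ω₂ is a
-- shortest path. The edge uv joins a level to the next one up, so a descending walk can only
-- cross it from v down to u; at v it descends to t instead. Gluing two descending walks at ω₂
-- connects any two points of Ĝ - uv.
module Submission where

open import Defs
open import Data.List using (List)
open import Data.Integer using (ℤ; +_)
open import Data.Product using (Σ; _×_; proj₂)
open import Data.List.Membership.Propositional using (_∈_)
open import Relation.Nullary using (¬_)
open import Relation.Binary.PropositionalEquality using (_≡_; _≢_)

open import Data.Nat as ℕ using (zero; suc; z≤n; s≤s; _⊔_)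
import Data.Nat.Properties as ℕ
open import Data.Integer using (_+_; _-_; -_; _⊖_; ∣_∣; _≤_; +≤+; pred; _≟_) renaming (suc to sucℤ)
import Data.Integer.Properties as ℤ
open import Data.Integer.Tactic.RingSolver using (solve-∀)
open import Data.Product using (_,_; proj₁; ∃)
open import Data.Product.Properties using (≡-dec)
open import Data.Sum using (_⊎_; inj₁; inj₂; [_,_]; map₁)
open import Data.Bool using (true)
open import Data.Fin using (Fin)
open import Function using (_∘_)
open import Function.Bundles using (_⇔_; Equivalence)
open import Relation.Nullary using (yes; no)
open import Relation.Binary.PropositionalEquality
  using (refl; sym; trans; cong; cong₂; subst; subst₂; module ≡-Reasoning)

∣m-n∣≤1 : ∀ {m n} → m ℕ.≤ suc n → n ℕ.≤ suc m → ℕ.∣ m - n ∣ ℕ.≤ 1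
∣m-n∣≤1 {zero}        {zero}        _        _       = z≤n
∣m-n∣≤1 {zero}        {suc zero}    _        _       = ℕ.≤-refl
∣m-n∣≤1 {suc zero}    {zero}        _        _       = ℕ.≤-refl
∣m-n∣≤1 {zero}        {suc (suc n)} _        (s≤s ())
∣m-n∣≤1 {suc (suc m)} {zero}        (s≤s ()) _
∣m-n∣≤1 {suc m}       {suc n}       (s≤s p)  (s≤s q) = ∣m-n∣≤1 p q

∣m⊖n∣≡∣m-n∣ : ∀ m n → ∣ m ⊖ n ∣ ≡ ℕ.∣ m - n ∣
∣m⊖n∣≡∣m-n∣ m n with ℕ.≤-total m n
... | inj₁ m≤n = trans (ℤ.∣⊖∣-≤ m≤n) (sym (ℕ.m≤n⇒∣m-n∣≡n∸m m≤n))
... | inj₂ n≤m = trans (ℤ.∣m⊖n∣≡∣n⊖m∣ m n)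
                       (trans (ℤ.∣⊖∣-≤ n≤m) (sym (trans (ℕ.∣-∣-comm m n) (ℕ.m≤n⇒∣m-n∣≡n∸m n≤m))))

∣+m-+n∣≡∣m-n∣ : ∀ m n → ∣ + m - + n ∣ ≡ ℕ.∣ m - n ∣
∣+m-+n∣≡∣m-n∣ m n = trans (cong ∣_∣ (ℤ.[+m]-[+n]≡m⊖n m n)) (∣m⊖n∣≡∣m-n∣ m n)

[i+j]-i≡j : ∀ i j → i + j - i ≡ j
[i+j]-i≡j = solve-∀

i≤j+∣i-j∣ : ∀ i j → i ≤ j + + ∣ i - j ∣
i≤j+∣i-j∣ i j with ℤ.≤-total i j
... | inj₁ i≤j = subst (i ≤_) (ℤ.+-comm _ j) (ℤ.i≤j⇒i≤k+j (+ ∣ i - j ∣) i≤j)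
... | inj₂ j≤i = ℤ.≤-reflexive (begin
  i                   ≡⟨ [i+j]-i≡j j i ⟨
  j + i - j           ≡⟨ ℤ.+-assoc j i (- j) ⟩
  j + (i - j)         ≡⟨ cong (λ d → j + d) (ℤ.∣-∣-≤ j≤i) ⟨
  j + + ∣ j - i ∣     ≡⟨ cong (λ d → j + + d) (ℤ.∣i-j∣≡∣j-i∣ j i) ⟩
  j + + ∣ i - j ∣     ∎)
  where open ≡-Reasoning

[1+i]-i≡1 : ∀ i → + 1 + i - i ≡ + 1
[1+i]-i≡1 = solve-∀

[i+1]-[i+2]≡-1 : ∀ i → i + + 1 - (i + + 2) ≡ - + 1
[i+1]-[i+2]≡-1 = solve-∀

suc[suc[i]]≡i+2 : ∀ i → + 1 + (+ 1 + i) ≡ i + + 2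
suc[suc[i]]≡i+2 = solve-∀

sucℤ-injective : ∀ {i j} → sucℤ i ≡ sucℤ j → i ≡ j
sucℤ-injective {i} {j} eq = trans (sym (ℤ.pred-suc i)) (trans (cong pred eq) (ℤ.pred-suc j))

i≢i+[1+n] : ∀ i n → i ≢ i + + suc n
i≢i+[1+n] i n eq
  with trans (sym ([i+j]-i≡j i (+ suc n))) (trans (cong (_- i) (sym eq)) (ℤ.+-inverseʳ i))
... | ()

Adj-sym : ∀ {a b} → Adj a b → Adj b a
Adj-sym {a₁ , a₂} {b₁ , b₂} = trans (cong₂ _⊔_ (ℤ.∣i-j∣≡∣j-i∣ b₁ a₁) (ℤ.∣i-j∣≡∣j-i∣ b₂ a₂))

Adj-down : ∀ {a₁ a₂ b₁ b₂} → ∣ a₁ - b₁ ∣ ℕ.≤ 1 → a₂ ≡ sucℤ b₂ → Adj (a₁ , a₂) (b₁ , b₂)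
Adj-down {a₁} {_} {b₁} {b₂} Δ₁≤1 refl =
  trans (cong (λ d → ∣ a₁ - b₁ ∣ ⊔ ∣ d ∣) ([1+i]-i≡1 b₂))
        (ℕ.m≤n⇒m⊔n≡n Δ₁≤1)

Adj⇒snd≤suc : ∀ {a b} → Adj a b → proj₂ b ≤ sucℤ (proj₂ a)
Adj⇒snd≤suc {a₁ , a₂} {b₁ , b₂} a~b = begin
  b₂                     ≤⟨ i≤j+∣i-j∣ b₂ a₂ ⟩
  a₂ + + ∣ b₂ - a₂ ∣     ≤⟨ ℤ.+-monoʳ-≤ a₂ (+≤+ Δ₂≤1) ⟩
  a₂ + + 1               ≡⟨ ℤ.+-comm a₂ (+ 1) ⟩
  sucℤ a₂               ∎
  where
  open ℤ.≤-Reasoning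
  Δ₂≤1 : ∣ b₂ - a₂ ∣ ℕ.≤ 1
  Δ₂≤1 = subst (ℕ._≤ 1) (ℤ.∣i-j∣≡∣j-i∣ a₂ b₂)
           (subst (∣ a₂ - b₂ ∣ ℕ.≤_) a~b (ℕ.m≤n⊔m ∣ a₁ - b₁ ∣ ∣ a₂ - b₂ ∣))

module _ {S : List Pt} where

  source∈ : ∀ {a b} → Walk S a b → a ∈ S
  source∈ (stay a∈) = a∈
  source∈ (step a∈ _ _) = a∈

  _++_ : ∀ {a b c} → Walk S a b → Walk S b c → Walk S a c
  stay _       ++ w′ = w′
  step a∈ e w  ++ w′ = step a∈ e (w ++ w′)

  len-++ : ∀ {a b c} (w : Walk S a b) (w′ : Walk S b c) → len (w ++ w′) ≡ len w ℕ.+ len w′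
  len-++ (stay _)     w′ = refl
  len-++ (step _ _ w) w′ = cong suc (len-++ w w′)

  UsesEdge-++⁻ : ∀ {u v a b c} (w : Walk S a b) (w′ : Walk S b c) →
                 UsesEdge u v (w ++ w′) → UsesEdge u v w ⊎ UsesEdge u v w′
  UsesEdge-++⁻ (stay _)     w′ uses         = inj₂ uses
  UsesEdge-++⁻ (step _ _ w) w′ (inj₁ here)  = inj₁ (inj₁ here)
  UsesEdge-++⁻ (step _ _ w) w′ (inj₂ there) = map₁ inj₂ (UsesEdge-++⁻ w w′ there)

  reverse : ∀ {a b} → Walk S a b → Walk S b a
  reverse (stay a∈) = stay a∈
  reverse {a} (step {b = c} a∈ a~c w) =
    reverse w ++ step (source∈ w) (Adj-sym {a} {c} a~c) (stay a∈)

  len-reverse : ∀ {a b} (w : Walk S a b) → len (reverse w) ≡ len w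
  len-reverse (stay _)     = refl
  len-reverse (step _ _ w) = begin
    len (reverse w ++ _)  ≡⟨ len-++ (reverse w) _ ⟩
    len (reverse w) ℕ.+ 1 ≡⟨ cong (ℕ._+ 1) (len-reverse w) ⟩
    len w ℕ.+ 1           ≡⟨ ℕ.+-comm (len w) 1 ⟩
    suc (len w)           ∎
    where open ≡-Reasoning

  UsesEdge-reverse⁻ : ∀ {u v a b} (w : Walk S a b) → UsesEdge u v (reverse w) → UsesEdge u v w
  UsesEdge-reverse⁻ (step _ _ w) uses with UsesEdge-++⁻ (reverse w) _ uses
  ... | inj₁ inner                         = inj₂ (UsesEdge-reverse⁻ w inner)
  ... | inj₂ (inj₁ (inj₁ (c≡u , a≡v)))     = inj₁ (inj₂ (a≡v , c≡u))
  ... | inj₂ (inj₁ (inj₂ (c≡v , a≡u)))     = inj₁ (inj₁ (a≡u , c≡v))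

  snd≤snd+len : ∀ {a b} (w : Walk S a b) → proj₂ b ≤ proj₂ a + + len w
  snd≤snd+len {a} (stay _) = ℤ.≤-reflexive (sym (ℤ.+-identityʳ (proj₂ a)))
  snd≤snd+len {a} {b} (step {b = c} _ a~c w) = begin
    proj₂ b                       ≤⟨ snd≤snd+len w ⟩
    proj₂ c + + len w             ≤⟨ ℤ.+-monoˡ-≤ (+ len w) (Adj⇒snd≤suc {a} {c} a~c) ⟩
    sucℤ (proj₂ a) + + len w      ≡⟨ cong (_+ + len w) (ℤ.+-comm (+ 1) (proj₂ a)) ⟩
    proj₂ a + + 1 + + len w       ≡⟨ ℤ.+-assoc (proj₂ a) (+ 1) (+ len w) ⟩
    proj₂ a + + suc (len w)       ∎
    where open ℤ.≤-Reasoning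

  level-walk-shortest : ∀ {a b k} → proj₂ a ≡ + 0 → proj₂ b ≡ + k →
                        (w : Walk S a b) → len w ≡ k → Shortest w
  level-walk-shortest {a} {b} a₀ bₖ w refl w′ =
    ℤ.drop‿+≤+ (subst₂ _≤_ bₖ (cong (_+ + len w′) a₀) (snd≤snd+len w′))

module _ {G : Graph} where
  open Graph G using (n; E)

  HasDist-unique : ∀ {a b m k} → HasDist G a b m → HasDist G a b k → m ≡ k
  HasDist-unique ((w , refl) , min) ((w′ , refl) , min′) = ℕ.≤-antisym (min w′) (min′ w)

  HasDist-0⇒≡ : ∀ {a b} → HasDist G a b 0 → a ≡ b
  HasDist-0⇒≡ ((gstay , _) , _) = refl

  HasDist-suc⇒next : ∀ {a c k} → HasDist G a c (suc k) →
                     Σ (Fin n) λ h → E a h ≡ true × HasDist G h c k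
  HasDist-suc⇒next ((gstep a~h w , refl) , min) =
    _ , a~h , (w , refl) , λ w′ → ℕ.s≤s⁻¹ (min (gstep a~h w′))

  HasDist-edge-≤ : ∀ {a b c m k} → E a b ≡ true → HasDist G a c m → HasDist G b c k →
                   m ℕ.≤ suc k
  HasDist-edge-≤ a~b (_ , min) ((w , refl) , _) = min (gstep a~b w)

  HasDist-edge-∣-∣≤1 : ∀ {a b c m k} → E a b ≡ true → HasDist G a c m → HasDist G b c k →
                       ℕ.∣ m - k ∣ ℕ.≤ 1
  HasDist-edge-∣-∣≤1 {a} {b} a~b dₐ d_b =
    ∣m-n∣≤1 (HasDist-edge-≤ a~b dₐ d_b) (HasDist-edge-≤ (trans (Graph.sym G b a) a~b) d_b dₐ)

  HasDistℤ-≡ : ∀ {a c z k} → HasDistℤ G a c z → HasDist G a c k → z ≡ + k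
  HasDistℤ-≡ (_ , refl , d) d′ = cong +_ (HasDist-unique d d′)

-- In each of (i)–(iv), t lies on the level of u and is adjacent to v, which lies one level
-- higher; this is all the argument uses.
record Bypass (S : List Pt) (u v : Pt) : Set where
  field
    t     : Pt
    t∈S   : t ∈ S
    v~t   : Adj v t
    t≢u   : t ≢ u
    snd-u : proj₂ u ≡ proj₂ t
    snd-v : proj₂ v ≡ sucℤ (proj₂ t)

Config⇒Bypass : ∀ {S α β u v} → Config S α β u v → Bypass S u v
Config⇒Bypass {α = α} {β} (inj₁ (refl , refl , t∈S)) = record
  { t = α , β ; t∈S = t∈S
  ; v~t = cong₂ (λ x y → ∣ x ∣ ⊔ ∣ y ∣) (ℤ.+-inverseʳ α) ([i+j]-i≡j β (+ 1))
  ; t≢u = i≢i+[1+n] α 0 ∘ cong proj₁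
  ; snd-u = refl ; snd-v = ℤ.+-comm β (+ 1) }
Config⇒Bypass {α = α} {β} (inj₂ (inj₁ (refl , refl , t∈S))) = record
  { t = α , β ; t∈S = t∈S
  ; v~t = cong₂ (λ x y → ∣ x ∣ ⊔ ∣ y ∣) ([i+j]-i≡j α (+ 1)) ([i+j]-i≡j β (+ 1))
  ; t≢u = i≢i+[1+n] α 0 ∘ cong proj₁
  ; snd-u = refl ; snd-v = ℤ.+-comm β (+ 1) }
Config⇒Bypass {α = α} {β} (inj₂ (inj₂ (inj₁ (refl , refl , t∈S)))) = record
  { t = α , β ; t∈S = t∈S
  ; v~t = cong₂ (λ x y → ∣ x ∣ ⊔ ∣ y ∣) ([i+j]-i≡j α (+ 1)) ([i+j]-i≡j β (+ 1))
  ; t≢u = i≢i+[1+n] α 1 ∘ cong proj₁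
  ; snd-u = refl ; snd-v = ℤ.+-comm β (+ 1) }
Config⇒Bypass {α = α} {β} (inj₂ (inj₂ (inj₂ (refl , refl , t∈S)))) = record
  { t = α + + 2 , β ; t∈S = t∈S
  ; v~t = cong₂ (λ x y → ∣ x ∣ ⊔ ∣ y ∣) ([i+1]-[i+2]≡-1 α) ([i+j]-i≡j β (+ 1))
  ; t≢u = i≢i+[1+n] α 1 ∘ sym ∘ cong proj₁
  ; snd-u = refl ; snd-v = ℤ.+-comm β (+ 1) }

module Realization {S : List Pt} (G : Graph) (ω₁ ω₂ : Fin (Graph.n G)) (r : Fin (Graph.n G) → Pt)
  (dist : ∀ g → HasDistℤ G g ω₁ (proj₁ (r g)) × HasDistℤ G g ω₂ (proj₂ (r g)))
  (image : ∀ p → (p ∈ S) ⇔ (∃ λ g → r g ≡ p)) where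

  open Graph G using (E)
  open Equivalence

  snd-ℕ : ∀ {p} → p ∈ S → ∃ λ k → proj₂ p ≡ + k
  snd-ℕ {p} p∈ with to (image p) p∈
  ... | g , refl with proj₂ (dist g)
  ... | k , eₖ , _ = k , eₖ

  snd≡0⇒≡ω₂ : ∀ {p} → p ∈ S → proj₂ p ≡ + 0 → p ≡ r ω₂
  snd≡0⇒≡ω₂ {p} p∈ p₀ with to (image p) p∈
  ... | g , refl with proj₂ (dist g)
  ... | k , eₖ , d with ℤ.+-injective (trans (sym eₖ) p₀)
  ... | refl = cong r (HasDist-0⇒≡ d)

  snd≡0-unique : ∀ {p q} → p ∈ S → q ∈ S → proj₂ p ≡ + 0 → proj₂ q ≡ + 0 → p ≡ q
  snd≡0-unique p∈ q∈ p₀ q₀ = trans (snd≡0⇒≡ω₂ p∈ p₀) (sym (snd≡0⇒≡ω₂ q∈ q₀))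

  edge⇒Adj : ∀ {g h k} → E g h ≡ true → HasDist G g ω₂ (suc k) → HasDist G h ω₂ k →
             Adj (r g) (r h)
  edge⇒Adj {g} {h} g~h d₂g d₂h with proj₁ (dist g) | proj₁ (dist h)
  ... | a , eₐ , d₁g | b , e_b , d₁h =
    Adj-down {proj₁ (r g)} {proj₂ (r g)} {proj₁ (r h)} {proj₂ (r h)}
      (subst₂ (λ x y → ∣ x - y ∣ ℕ.≤ 1) (sym eₐ) (sym e_b)
        (subst (ℕ._≤ 1) (sym (∣+m-+n∣≡∣m-n∣ a b)) (HasDist-edge-∣-∣≤1 g~h d₁g d₁h)))
      (trans (HasDistℤ-≡ (proj₂ (dist g)) d₂g)
             (cong sucℤ (sym (HasDistℤ-≡ (proj₂ (dist h)) d₂h))))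

  descend : ∀ {p k} → p ∈ S → proj₂ p ≡ + suc k → Σ Pt λ q → q ∈ S × Adj p q × proj₂ q ≡ + k
  descend {p} p∈ pₖ with to (image p) p∈
  ... | g , refl with proj₂ (dist g)
  ... | m , eₘ , d₂g with ℤ.+-injective (trans (sym eₘ) pₖ)
  ... | refl with HasDist-suc⇒next d₂g
  ... | h , g~h , d₂h =
    r h , from (image (r h)) (h , refl) , edge⇒Adj g~h d₂g d₂h , HasDistℤ-≡ (proj₂ (dist h)) d₂h

  module Avoiding {o u v : Pt} (o∈ : o ∈ S) (o₀ : proj₂ o ≡ + 0) (bypass : Bypass S u v) where
    open Bypass bypass

    descending-edge≢uv : ∀ {a b} → proj₂ a ≡ sucℤ (proj₂ b) → ¬ (a ≡ v × b ≡ u) →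
                         ¬ ((a ≡ u × b ≡ v) ⊎ (a ≡ v × b ≡ u))
    descending-edge≢uv a↓b _ (inj₁ (refl , refl)) =
      i≢i+[1+n] (proj₂ u) 1
        (trans a↓b (trans (cong sucℤ v↑u) (suc[suc[i]]≡i+2 (proj₂ u))))
      where
      v↑u : proj₂ v ≡ sucℤ (proj₂ u)
      v↑u = trans snd-v (cong sucℤ (sym snd-u))
    descending-edge≢uv _ ¬vu (inj₂ vu) = ¬vu vu

    descent : ∀ k {p} → p ∈ S → proj₂ p ≡ + k →
              Σ (Walk S p o) λ w → len w ≡ k × ¬ UsesEdge u v w
    descent zero p∈ p₀ with snd≡0-unique p∈ o∈ p₀ o₀
    ... | refl = stay p∈ , refl , λ ()
    descent (suc k) {p} p∈ pₖ with ≡-dec _≟_ _≟_ p v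
    ... | yes refl with descent k t∈S (sucℤ-injective (trans (sym snd-v) pₖ))
    ...   | w , lenₖ , ¬uses =
      step p∈ v~t w , cong suc lenₖ , [ descending-edge≢uv snd-v (t≢u ∘ proj₂) , ¬uses ]
    descent (suc k) {p} p∈ pₖ | no p≢v with descend p∈ pₖ
    ...   | q , q∈ , p~q , qₖ with descent k q∈ qₖ
    ...     | w , lenₖ , ¬uses =
      step p∈ p~q w , cong suc lenₖ ,
      [ descending-edge≢uv (trans pₖ (cong sucℤ (sym qₖ))) (p≢v ∘ proj₁) , ¬uses ]

    o≢u : o ≢ u
    o≢u o≡u = t≢u (trans (snd≡0-unique t∈S o∈ t₀ o₀) o≡u)
      where
      t₀ : proj₂ t ≡ + 0
      t₀ = trans (sym snd-u) (trans (cong proj₂ (sym o≡u)) o₀)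

    shortest-avoiding : ∀ {x} → x ∈ S → Σ (Walk S o x) λ w → Shortest w × ¬ UsesEdge u v w
    shortest-avoiding x∈ with snd-ℕ x∈
    ... | k , xₖ with descent k x∈ xₖ
    ... | w , lenₖ , ¬uses =
      reverse w , level-walk-shortest o₀ xₖ (reverse w) (trans (len-reverse w) lenₖ) ,
      ¬uses ∘ UsesEdge-reverse⁻ w

    connected-avoiding : ConnectedMinusEdge S u v
    connected-avoiding a b a∈ b∈ with snd-ℕ a∈ | snd-ℕ b∈
    ... | i , aᵢ | j , bⱼ with descent i a∈ aᵢ | descent j b∈ bⱼ
    ... | wₐ , _ , ¬usesₐ | w_b , _ , ¬uses_b =
      wₐ ++ reverse w_b ,
      [ ¬usesₐ , ¬uses_b ∘ UsesEdge-reverse⁻ w_b ] ∘ UsesEdge-++⁻ wₐ (reverse w_b)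

lemma11 : (S : List Pt) → Realizable S →
          (ω₂ : Pt) → ω₂ ∈ S → proj₂ ω₂ ≡ + 0 →
          (x : Pt) → x ∈ S → (u v : Pt) → (α β : ℤ) → Config S α β u v →
          (w : Walk S ω₂ x) → Shortest w → UsesEdge u v w →
          (ω₂ ≢ u) × (Σ (Walk S ω₂ x) λ w' → Shortest w' × ¬ UsesEdge u v w') × ConnectedMinusEdge S u v
lemma11 S (G , _ , o₁ , o₂ , r , dist , _ , image) ω₂ ω₂∈ ω₂₀ x x∈ u v α β config _ _ _ =
  o≢u , shortest-avoiding x∈ , connected-avoiding
  where
  open Realization G o₁ o₂ r dist image
  open Avoiding ω₂∈ ω₂₀ (Config⇒Bypass config)
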